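{- Let $w\in S_n$, let $J\subseteq S$, and let $v\in S_n$ be such that $wv$ is the unique element of maximal length in the coset $wW_J$. Let $[a,b]$ be the interval of positions corresponding to a connected component of $J$. Then the following are equivalent: (1) $a$ is strong left-$wv$-directed; (2) $\lambda_w(b)=v(a)$; (3) $v(a)$ is strong left-$w$-directed; (4) $\lambda_w(p)\in[a,b]$ for some position $p$.
   Context: Permutations $w\in S_n$ are functions on positions $\{1,\dots,n\}$, $w(p)$ being the value at position $p$, with product $(wv)(p)=w(v(p))$. $S=\{s_1,\dots,s_{n-1}\}$ with $s_i$ the transposition of $i$ and $i+1$; for $J\subseteq S$, $W_J$ is the subgroup generated by $J$. A connected component of $J$ is a maximal subset of the form $\{s_a,s_{a+1},\dots,s_{b-1}\}$ ($a<b$), and the corresponding interval of positions is $[a,b]=\{a,\dots,b\}$. The maximal-length element of $wW_J$ is obtained from $w$ by rearranging, on each such interval, the values in decreasing order. For $w\in S_n$ and a position $p$, $\lambda_w(p)$ denotes the unique position $q\le p$ maximizing $w(q)$ among positions $\le p$, and $\rho_w(p)$ the unique position $q\ge p$ minimizing $w(q)$ among positions $\ge p$. A position $p$ is strong left-$w$-directed if $\lambda_w(p)=p$, strong right-$w$-directed if $\rho_w(p)=p$. -}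

module Defs where

open import Data.Nat as ℕ using (ℕ; zero; suc)
open import Data.Fin using (Fin; toℕ; _<?_; _≤_; _<_)
open import Data.Fin.Permutation using (Permutation′; _⟨$⟩ʳ_; _∘ₚ_; id; transpose; _≈_)
open import Data.List using (List; map; allFin)
open import Data.Nat.ListAction using (sum)
open import Data.Bool using (if_then_else_; _∧_)
open import Relation.Nullary using (does; ¬_)
open import Relation.Binary.PropositionalEquality using (_≡_)
open import Data.Product using (_×_)

-- Permutations of the positions Fin n (positions are 0-based: 0,…,n-1).
Perm : ℕ → Set
Perm n = Permutation′ n

_$_ : ∀ {n} → Perm n → Fin n → Fin n
w $ p = w ⟨$⟩ʳ p

-- product (w · v)(p) = w (v p)   (note: stdlib's _∘ₚ_ is diagrammatic)
_·_ : ∀ {n} → Perm n → Perm n → Perm n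
w · v = v ∘ₚ w

-- A subset J of the simple transpositions is given as a predicate on ℕ:
-- J k means that the simple transposition exchanging the (0-based) positions
-- k and k+1 (the paper's s_{k+1}) belongs to J.
-- Parabolic subgroup W_J: the subgroup generated by J (products of generators;
-- generators are involutions, so this is the generated subgroup).
data InW {n : ℕ} (J : ℕ → Set) : Perm n → Set where
  W-id  : InW J id
  W-gen : ∀ {u} (i j : Fin n) → toℕ j ≡ suc (toℕ i) → J (toℕ i) →
          InW J u → InW J (transpose i j · u)

-- Coxeter length in S_n = number of inversions.
len : ∀ {n} → Perm n → ℕ
len {n} w = sum (map (λ i → sum (map (λ j →
  if does (i <? j) ∧ does ((w $ j) <? (w $ i)) then 1 else 0) (allFin n))) (allFin n))

IsMaxInCoset : ∀ {n} (J : ℕ → Set) (w v : Perm n) → Set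
IsMaxInCoset {n} J w v =
  InW J v × (∀ (u : Perm n) → InW J u → ¬ (u ≈ v) → len (w · u) ℕ.< len (w · v))

-- [a,b] (0-based positions) is the interval of positions of a connected
-- component {s_a,…,s_{b-1}} of J: a < b, all of it lies in J, and it is
-- maximal (the transpositions (a-1,a) and (b,b+1) are not in J).
IsComponent : ∀ {n} (J : ℕ → Set) (a b : Fin n) → Set
IsComponent J a b =
  (a < b) ×
  (∀ k → toℕ a ℕ.≤ k → k ℕ.< toℕ b → J k) ×
  (∀ k → suc k ≡ toℕ a → ¬ J k) ×
  ¬ J (toℕ b)

-- IsLeftMax w p q : q = λ_w(p), i.e. q ≤ p and w(q) is maximal among w(q'), q' ≤ p.
IsLeftMax : ∀ {n} → Perm n → Fin n → Fin n → Set
IsLeftMax {n} w p q = (q ≤ p) × (∀ (q' : Fin n) → q' ≤ p → (w $ q') ≤ (w $ q))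

StrongLeftDirected : ∀ {n} → Perm n → Fin n → Set
StrongLeftDirected w p = IsLeftMax w p p

-- Since v lies in W_J and J contains neither s_{a-1} nor s_b, v permutes the
-- positions < a among themselves and the positions of [a,b] among themselves.
-- Maximality of wv in its coset forces wv to be decreasing on [a,b]: at an
-- ascent k < k+1 inside the component, wv·s_k lies in the same coset and has
-- at least as many inversions. Hence w(v a) is the maximum of w on [a,b], and
-- all four conditions amount to saying that no position to the left of a
-- carries a larger value of w.
module Submission where

open import Data.Bool using (if_then_else_; _∧_)
open import Data.Empty using (⊥-elim)
open import Data.Fin as F using (Fin; toℕ; _≤_; _<_; _<?_; _≟_)
import Data.Fin.Induction as FinInd
open import Data.Fin.Permutation using (_≈_; flip; transpose; inverseʳ; inverseˡ; _⟨$⟩ˡ_)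
  renaming (id to idₚ)
import Data.Fin.Permutation.Components as PC
import Data.Fin.Properties as FinP
open import Data.List as List using (map; allFin)
open import Data.List.Properties using (map-tabulate)
open import Data.Nat as ℕ using (ℕ; suc) renaming (_<_ to _<ℕ_; _≤_ to _≤ℕ_)
import Data.Nat.ListAction as ListAction
import Data.Nat.Properties as ℕ
open import Data.Product as Prod using (_×_; _,_; ∃; ∃₂; proj₁; proj₂)
open import Data.Sum using (_⊎_; inj₁; inj₂)
open import Function using (_∘_; id)
open import Function.Bundles using (_⇔_; mk⇔; Equivalence)
open import Function.Construct.Composition using (_⇔-∘_)
open import Function.Construct.Identity using (⇔-id)
open import Function.Construct.Symmetry using (⇔-sym)
open import Relation.Binary.PropositionalEquality
open import Relation.Nullary using (¬_; Dec; does; yes; no)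

open import Defs
open import Algebra.Properties.CommutativeMonoid.Sum ℕ.+-0-commutativeMonoid
  using (sum; sum-cong-≗; sum-permute)

Adjacent : ∀ {n} → Fin n → Fin n → Set
Adjacent k k' = toℕ k' ≡ suc (toℕ k)

adjacent⇒< : ∀ {n} {k k' : Fin n} → Adjacent k k' → k < k'
adjacent⇒< adj = ℕ.≤-reflexive (sym adj)

transpose-cases : ∀ {n} (i j q : Fin n) →
  (q ≡ i × PC.transpose i j q ≡ j) ⊎ (q ≡ j × PC.transpose i j q ≡ i) ⊎
  (q ≢ i × q ≢ j × PC.transpose i j q ≡ q)
transpose-cases i j q with q ≟ i
... | yes q≡i = inj₁ (q≡i , refl)
... | no q≢i with q ≟ j
...   | yes q≡j = inj₂ (inj₁ (q≡j , refl))
...   | no q≢j = inj₂ (inj₂ (q≢i , q≢j , refl))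

transpose-fst : ∀ {n} (i j : Fin n) → PC.transpose i j i ≡ j
transpose-fst i j with transpose-cases i j i
... | inj₁ (_ , e) = e
... | inj₂ (inj₁ (i≡j , e)) = trans e i≡j
... | inj₂ (inj₂ (i≢i , _)) = ⊥-elim (i≢i refl)

transpose-snd : ∀ {n} (i j : Fin n) → PC.transpose i j j ≡ i
transpose-snd i j with transpose-cases i j j
... | inj₁ (j≡i , e) = trans e j≡i
... | inj₂ (inj₁ (_ , e)) = e
... | inj₂ (inj₂ (_ , j≢j , _)) = ⊥-elim (j≢j refl)

transpose-involutive : ∀ {n} (i j q : Fin n) → PC.transpose i j (PC.transpose i j q) ≡ q
transpose-involutive i j q with transpose-cases i j q
... | inj₁ (refl , e) = trans (cong (PC.transpose i j) e) (transpose-snd i j)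
... | inj₂ (inj₁ (refl , e)) = trans (cong (PC.transpose i j) e) (transpose-fst i j)
... | inj₂ (inj₂ (_ , _ , e)) = trans (cong (PC.transpose i j) e) e

transpose-adjacent-preserves-< : ∀ {n} {k k' i j : Fin n} → Adjacent k k' →
  i < j → ¬ (i ≡ k × j ≡ k') → PC.transpose k k' i < PC.transpose k k' j
transpose-adjacent-preserves-< {k = k} {k'} {i} {j} adj i<j ¬kk'
  with transpose-cases k k' i | transpose-cases k k' j
... | inj₁ (refl , _) | inj₁ (refl , _) = ⊥-elim (ℕ.<-irrefl refl i<j)
... | inj₁ (refl , _) | inj₂ (inj₁ (refl , _)) = ⊥-elim (¬kk' (refl , refl))
... | inj₁ (refl , e) | inj₂ (inj₂ (_ , j≢k' , e')) rewrite e | e' =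
  FinP.≤∧≢⇒< (subst (_≤ℕ toℕ j) (sym adj) i<j) (j≢k' ∘ sym)
... | inj₂ (inj₁ (refl , _)) | inj₁ (refl , _) = ⊥-elim (ℕ.<-asym i<j (adjacent⇒< adj))
... | inj₂ (inj₁ (refl , _)) | inj₂ (inj₁ (refl , _)) = ⊥-elim (ℕ.<-irrefl refl i<j)
... | inj₂ (inj₁ (refl , e)) | inj₂ (inj₂ (_ , _ , e')) rewrite e | e' =
  ℕ.<-trans (adjacent⇒< adj) i<j
... | inj₂ (inj₂ (_ , _ , e)) | inj₁ (refl , e') rewrite e | e' =
  ℕ.<-trans i<j (adjacent⇒< adj)
... | inj₂ (inj₂ (i≢k , _ , e)) | inj₂ (inj₁ (refl , e')) rewrite e | e' =
  FinP.≤∧≢⇒< (ℕ.≤-pred (subst (toℕ i <ℕ_) adj i<j)) i≢k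
... | inj₂ (inj₂ (_ , _ , e)) | inj₂ (inj₂ (_ , _ , e')) rewrite e | e' = i<j

listSum-allFin : ∀ {n} (f : Fin n → ℕ) → ListAction.sum (map f (allFin n)) ≡ sum f
listSum-allFin f = trans (cong ListAction.sum (map-tabulate id f)) (listSum-tabulate f)
  where
  listSum-tabulate : ∀ {m} (g : Fin m → ℕ) → ListAction.sum (List.tabulate g) ≡ sum g
  listSum-tabulate {ℕ.zero} g = refl
  listSum-tabulate {suc m} g = cong (g F.zero ℕ.+_) (listSum-tabulate (g ∘ F.suc))

sum-mono-≤ : ∀ {n} {f g : Fin n → ℕ} → (∀ i → f i ≤ℕ g i) → sum f ≤ℕ sum g
sum-mono-≤ {ℕ.zero} _ = ℕ.z≤n
sum-mono-≤ {suc n} f≤g = ℕ.+-mono-≤ (f≤g F.zero) (sum-mono-≤ (f≤g ∘ F.suc))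

sum₂-permute : ∀ {n} (g : Fin n → Fin n → ℕ) (π : Perm n) →
  sum (λ i → sum (λ j → g i j)) ≡ sum (λ i → sum (λ j → g (π $ i) (π $ j)))
sum₂-permute g π =
  trans (sum-permute (λ i → sum (g i)) π) (sum-cong-≗ λ i → sum-permute (g (π $ i)) π)

indicator-mono : ∀ {P Q R : Set} (p : Dec P) (q : Dec Q) (r : Dec R) → (P → Q → R) →
  (if does p ∧ does q then 1 else 0) ≤ℕ (if does r ∧ does q then 1 else 0)
indicator-mono (no _) _ _ _ = ℕ.z≤n
indicator-mono (yes _) (no _) _ _ = ℕ.z≤n
indicator-mono (yes _) (yes _) (yes _) _ = ℕ.≤-refl
indicator-mono (yes p) (yes q) (no ¬r) p→q→r = ⊥-elim (¬r (p→q→r p q))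

inversion : ∀ {n} → (Fin n → Fin n) → Fin n → Fin n → ℕ
inversion f i j = if does (i <? j) ∧ does (f j <? f i) then 1 else 0

inversions : ∀ {n} → (Fin n → Fin n) → ℕ
inversions f = sum λ i → sum λ j → inversion f i j

len≡inversions : ∀ {n} (w : Perm n) → len w ≡ inversions (w $_)
len≡inversions w =
  trans (listSum-allFin (λ i → ListAction.sum (map (inversion (w $_) i) (allFin _))))
        (sum-cong-≗ λ i → listSum-allFin (inversion (w $_) i))

inversions-cong : ∀ {n} {f g : Fin n → Fin n} → (∀ i → f i ≡ g i) →
  inversions f ≡ inversions g
inversions-cong f≗g = sum-cong-≗ λ i → sum-cong-≗ λ j →
  cong₂ (λ x y → if does (i <? j) ∧ does (x <? y) then 1 else 0) (f≗g j) (f≗g i)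

-- Reindexed by the involution σ, an inversion (i, j) of f becomes the pair
-- (σ i, σ j), which is still ordered unless (i, j) = (k, k'), an ascent of f.
inversions-≤-transposeAscent : ∀ {n} (f : Fin n → Fin n) {k k' : Fin n} →
  Adjacent k k' → f k < f k' → inversions f ≤ℕ inversions (f ∘ PC.transpose k k')
inversions-≤-transposeAscent f {k} {k'} adj ascent = begin
  inversions f
    ≤⟨ sum-mono-≤ (λ i → sum-mono-≤ (λ j →
         indicator-mono (i <? j) (f j <? f i) (σ i <? σ j) (σ-preserves-inversion i j))) ⟩
  sum (λ i → sum (λ j → if does (σ i <? σ j) ∧ does (f j <? f i) then 1 else 0))
    ≡⟨ sum-cong-≗ (λ i → sum-cong-≗ λ j →
         cong₂ (λ x y → if does (σ i <? σ j) ∧ does (f x <? f y) then 1 else 0)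
               (transpose-involutive k k' j) (transpose-involutive k k' i)) ⟨
  sum (λ i → sum (λ j → inversion (f ∘ σ) (σ i) (σ j)))
    ≡⟨ sum₂-permute (inversion (f ∘ σ)) (transpose k k') ⟨
  inversions (f ∘ σ) ∎
  where
  open ℕ.≤-Reasoning
  σ = PC.transpose k k'
  σ-preserves-inversion : ∀ i j → i < j → f j < f i → σ i < σ j
  σ-preserves-inversion i j i<j fj<fi =
    transpose-adjacent-preserves-< adj i<j λ { (refl , refl) → ℕ.<-asym fj<fi ascent }

InW-·-transpose : ∀ {n} {J : ℕ → Set} {u : Perm n} {k k' : Fin n} →
  Adjacent k k' → J (toℕ k) → InW J u → ∃ λ u' → InW J u' × u' ≈ u · transpose k k'
InW-·-transpose adj Jk W-id = transpose _ _ · idₚ , W-gen _ _ adj Jk W-id , λ _ → refl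
InW-·-transpose adj Jk (W-gen i j adj′ Ji u∈W) with InW-·-transpose adj Jk u∈W
... | u' , u'∈W , u'≈uσ =
  transpose i j · u' , W-gen i j adj′ Ji u'∈W , cong (PC.transpose i j) ∘ u'≈uσ

≉-·-transpose : ∀ {n} {u v : Perm n} {k k' : Fin n} → k ≢ k' →
  u ≈ v · transpose k k' → ¬ u ≈ v
≉-·-transpose {v = v} {k} {k'} k≢k' u≈vσ u≈v = k≢k' (begin
  k                                  ≡⟨ inverseˡ v ⟨
  v ⟨$⟩ˡ (v $ k)                     ≡⟨ cong (v ⟨$⟩ˡ_) (trans (sym (u≈v k)) (u≈vσ k)) ⟩
  v ⟨$⟩ˡ (v $ (PC.transpose k k' k)) ≡⟨ cong (λ q → v ⟨$⟩ˡ (v $ q)) (transpose-fst k k') ⟩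
  v ⟨$⟩ˡ (v $ k')                    ≡⟨ inverseˡ v ⟩
  k'                                 ∎)
  where open ≡-Reasoning

maxInCoset-descent : ∀ {n} {J : ℕ → Set} {w v : Perm n} → IsMaxInCoset J w v →
  ∀ {k k'} → Adjacent k k' → J (toℕ k) → (w · v) $ k' ≤ (w · v) $ k
maxInCoset-descent {w = w} {v} (v∈W , maximal) {k} {k'} adj Jk
  with InW-·-transpose adj Jk v∈W
... | u , u∈W , u≈vσ = ℕ.≮⇒≥ λ ascent → ℕ.<⇒≱ (maximal u u∈W u≉v) (len-≤ ascent)
  where
  u≉v : ¬ u ≈ v
  u≉v = ≉-·-transpose {u = u} {v} {k} {k'} (FinP.<⇒≢ (adjacent⇒< adj)) u≈vσ
  open ℕ.≤-Reasoning
  len-≤ : (w · v) $ k < (w · v) $ k' → len (w · v) ≤ℕ len (w · u)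
  len-≤ ascent = begin
    len (w · v)                                   ≡⟨ len≡inversions (w · v) ⟩
    inversions ((w · v) $_)                       ≤⟨ inversions-≤-transposeAscent _ adj ascent ⟩
    inversions (((w · v) $_) ∘ PC.transpose k k') ≡⟨ inversions-cong (cong (w $_) ∘ u≈vσ) ⟨
    inversions ((w · u) $_)                       ≡⟨ len≡inversions (w · u) ⟨
    len (w · u)                                   ∎

PreservesCut : ∀ {n} → ℕ → Perm n → Set
PreservesCut c π = ∀ q → toℕ q <ℕ c ⇔ toℕ (π $ q) <ℕ c

adjacent-<-cut : ∀ {n} {k k' : Fin n} {c} → Adjacent k k' → suc (toℕ k) ≢ c →
  toℕ k <ℕ c ⇔ toℕ k' <ℕ c
adjacent-<-cut adj 1+k≢c rewrite adj =
  mk⇔ (λ k<c → ℕ.≤∧≢⇒< k<c 1+k≢c) (ℕ.<-trans (ℕ.n<1+n _))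

transpose-preservesCut : ∀ {n} {k k' : Fin n} {c} → Adjacent k k' → suc (toℕ k) ≢ c →
  PreservesCut c (transpose k k')
transpose-preservesCut {k = k} {k'} adj 1+k≢c q with transpose-cases k k' q
... | inj₁ (refl , e) rewrite e = adjacent-<-cut adj 1+k≢c
... | inj₂ (inj₁ (refl , e)) rewrite e = ⇔-sym (adjacent-<-cut adj 1+k≢c)
... | inj₂ (inj₂ (_ , _ , e)) rewrite e = ⇔-id _

preservesCut-· : ∀ {n} {c} {π ρ : Perm n} →
  PreservesCut c π → PreservesCut c ρ → PreservesCut c (π · ρ)
preservesCut-· {ρ = ρ} π-cut ρ-cut q = π-cut (ρ $ q) ⇔-∘ ρ-cut q

preservesCut-flip : ∀ {n} {c} {π : Perm n} → PreservesCut c π → PreservesCut c (flip π)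
preservesCut-flip {c = c} {π} π-cut q =
  ⇔-sym (subst (λ r → toℕ (π ⟨$⟩ˡ q) <ℕ c ⇔ toℕ r <ℕ c) (inverseʳ π)
               (π-cut (π ⟨$⟩ˡ q)))

InW-preservesCut : ∀ {n} {J : ℕ → Set} {c} → (∀ k → J k → suc k ≢ c) →
  ∀ {u : Perm n} → InW J u → PreservesCut c u
InW-preservesCut J-avoids W-id q = ⇔-id _
InW-preservesCut J-avoids (W-gen {u} i j adj Ji u∈W) =
  preservesCut-· {π = transpose i j} {u}
    (transpose-preservesCut adj (J-avoids _ Ji)) (InW-preservesCut J-avoids u∈W)

PreservesCutsAround : ∀ {n} → Fin n → Fin n → Perm n → Set
PreservesCutsAround a b π = PreservesCut (toℕ a) π × PreservesCut (suc (toℕ b)) π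

preservesCutsAround-flip : ∀ {n} {a b : Fin n} {π : Perm n} →
  PreservesCutsAround a b π → PreservesCutsAround a b (flip π)
preservesCutsAround-flip {π = π} =
  Prod.map (preservesCut-flip {π = π}) (preservesCut-flip {π = π})

preservesCutsAround⇒mapsInterval : ∀ {n} {a b : Fin n} {π : Perm n} →
  PreservesCutsAround a b π → ∀ {q} → a ≤ q → q ≤ b → a ≤ π $ q × π $ q ≤ b
preservesCutsAround⇒mapsInterval (a-cut , b-cut) {q} a≤q q≤b =
  ℕ.≮⇒≥ (λ πq<a → ℕ.≤⇒≯ a≤q (Equivalence.from (a-cut q) πq<a)) ,
  ℕ.≤-pred (Equivalence.to (b-cut q) (ℕ.s≤s q≤b))

component-preservesCutsAround : ∀ {n} {J : ℕ → Set} {a b : Fin n} → IsComponent J a b →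
  ∀ {u} → InW J u → PreservesCutsAround a b u
component-preservesCutsAround {J = J} (_ , _ , ¬J[a-1] , ¬J[b]) u∈W =
  InW-preservesCut (λ k Jk 1+k≡a → ¬J[a-1] k 1+k≡a Jk) u∈W ,
  InW-preservesCut (λ k Jk 1+k≡1+b → ¬J[b] (subst J (ℕ.suc-injective 1+k≡1+b) Jk)) u∈W

stepwise-antitone⇒≤-start : ∀ {m n} (f : Fin m → Fin n) {a b : Fin m} →
  (∀ {k k'} → Adjacent k k' → a ≤ k → k' ≤ b → f k' ≤ f k) →
  ∀ {q} → a ≤ q → q ≤ b → f q ≤ f a
stepwise-antitone⇒≤-start {suc m} f {a} {b} descent a≤q =
  FinInd.<-weakInduction-startingFrom P (λ _ _ → ℕ.≤-refl) step a≤q a≤q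
  where
  P : Fin (suc m) → Set
  P j = a ≤ j → j ≤ b → f j ≤ f a
  step : ∀ j → P (F.inject₁ j) → P (F.suc j)
  step j ih a≤1+j 1+j≤b with a F.≤? F.inject₁ j
  ... | yes a≤j = ℕ.≤-trans (descent adj a≤j 1+j≤b) (ih a≤j (ℕ.≤-trans j≤1+j 1+j≤b))
    where
    adj : Adjacent (F.inject₁ j) (F.suc j)
    adj = cong suc (sym (FinP.toℕ-inject₁ j))
    j≤1+j : F.inject₁ j ≤ F.suc j
    j≤1+j = ℕ.<⇒≤ (adjacent⇒< adj)
  ... | no a≰j = FinP.≤-reflexive (cong f (FinP.≤-antisym
    (subst (ℕ._< toℕ a) (FinP.toℕ-inject₁ j) (ℕ.≰⇒> a≰j)) a≤1+j))

record IsMaxOn {n} (w : Perm n) (a b c : Fin n) : Set where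
  constructor isMaxOn
  field
    lower   : a ≤ c
    upper   : c ≤ b
    maximum : ∀ r → a ≤ r → r ≤ b → w $ r ≤ w $ c

maxInCoset-maxOnComponent : ∀ {n} {J : ℕ → Set} {w v : Perm n} {a b : Fin n} →
  IsMaxInCoset J w v → IsComponent J a b → IsMaxOn w a b (v $ a)
maxInCoset-maxOnComponent {w = w} {v} {a} {b}
  maxInCoset@(v∈W , _) component@(a<b , J-inside , _) =
  isMaxOn (proj₁ v-a-bounds) (proj₂ v-a-bounds) w-bound
  where
  v-cuts : PreservesCutsAround a b v
  v-cuts = component-preservesCutsAround component v∈W
  v-a-bounds : a ≤ v $ a × v $ a ≤ b
  v-a-bounds = preservesCutsAround⇒mapsInterval {π = v} v-cuts FinP.≤-refl (ℕ.<⇒≤ a<b)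
  wv-bound : ∀ q → a ≤ q → q ≤ b → (w · v) $ q ≤ (w · v) $ a
  wv-bound q = stepwise-antitone⇒≤-start ((w · v) $_) λ {k} adj a≤k k'≤b →
    maxInCoset-descent {w = w} {v} maxInCoset adj
      (J-inside (toℕ k) a≤k (subst (ℕ._≤ toℕ b) adj k'≤b))
  v⁻¹-cuts : PreservesCutsAround a b (flip v)
  v⁻¹-cuts = preservesCutsAround-flip {π = v} v-cuts
  w-bound : ∀ r → a ≤ r → r ≤ b → w $ r ≤ w $ (v $ a)
  w-bound r a≤r r≤b with preservesCutsAround⇒mapsInterval {π = flip v} v⁻¹-cuts a≤r r≤b
  ... | a≤v⁻¹r , v⁻¹r≤b =
    subst (λ s → w $ s ≤ w $ (v $ a)) (inverseʳ v) (wv-bound (v ⟨$⟩ˡ r) a≤v⁻¹r v⁻¹r≤b)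

maxOn-dominates : ∀ {n} {w : Perm n} {a b c : Fin n} → IsMaxOn w a b c →
  (∀ q → q < a → w $ q ≤ w $ c) → ∀ q → q ≤ b → w $ q ≤ w $ c
maxOn-dominates {a = a} (isMaxOn _ _ max) below q q≤b with q <? a
... | yes q<a = below q q<a
... | no q≮a = max q (ℕ.≮⇒≥ q≮a) q≤b

maxOn-leftMax⇔strongLeftDirected : ∀ {n} {w : Perm n} {a b c : Fin n} → IsMaxOn w a b c →
  IsLeftMax w b c ⇔ StrongLeftDirected w c
maxOn-leftMax⇔strongLeftDirected maxOn@(isMaxOn a≤c c≤b _) = mk⇔
  (λ (_ , leftMax) → FinP.≤-refl , λ q q≤c → leftMax q (ℕ.≤-trans q≤c c≤b))
  (λ (_ , strong) → c≤b , maxOn-dominates maxOn λ q q<a →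
    strong q (ℕ.<⇒≤ (ℕ.<-≤-trans q<a a≤c)))

maxOn-strongLeftDirected⇔leftMaxIn : ∀ {n} {w : Perm n} {a b c : Fin n} → IsMaxOn w a b c →
  StrongLeftDirected w c ⇔ (∃₂ λ p q → IsLeftMax w p q × a ≤ q × q ≤ b)
maxOn-strongLeftDirected⇔leftMaxIn {c = c} maxOn@(isMaxOn a≤c c≤b max) = mk⇔
  (λ strong → c , c , strong , a≤c , c≤b)
  (λ (p , q , (q≤p , leftMax) , a≤q , q≤b) → FinP.≤-refl , λ t t≤c →
    maxOn-dominates maxOn
      (λ s s<a → ℕ.≤-trans (leftMax s (ℕ.<⇒≤ (ℕ.<-≤-trans s<a (ℕ.≤-trans a≤q q≤p))))
                           (max q a≤q q≤b))
      t (ℕ.≤-trans t≤c c≤b))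

·-strongLeftDirected⇔leftMax : ∀ {n} {w v : Perm n} {a b : Fin n} →
  PreservesCut (toℕ a) v → IsMaxOn w a b (v $ a) →
  StrongLeftDirected (w · v) a ⇔ IsLeftMax w b (v $ a)
·-strongLeftDirected⇔leftMax {w = w} {v} {a} {b} a-cut maxOn@(isMaxOn a≤c c≤b _) = mk⇔
  (λ (_ , strong) → c≤b , maxOn-dominates maxOn λ q q<a →
    subst (λ s → w $ s ≤ w $ (v $ a)) (inverseʳ v)
      (strong (v ⟨$⟩ˡ q) (ℕ.<⇒≤ (Equivalence.to (preservesCut-flip {π = v} a-cut q) q<a))))
  (λ leftMax → FinP.≤-refl , left-of-a leftMax)
  where
  left-of-a : IsLeftMax w b (v $ a) → ∀ t → t ≤ a → (w · v) $ t ≤ (w · v) $ a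
  left-of-a (_ , leftMax) t t≤a with t <? a
  ... | yes t<a =
    leftMax (v $ t) (ℕ.<⇒≤ (ℕ.<-≤-trans (Equivalence.to (a-cut t) t<a) (ℕ.≤-trans a≤c c≤b)))
  ... | no t≮a = FinP.≤-reflexive (cong ((w · v) $_) (FinP.≤-antisym t≤a (ℕ.≮⇒≥ t≮a)))

mainTheorem1 : ∀ {n : ℕ} (J : ℕ → Set) → (∀ k → J k → suc k <ℕ n) →
    (w v : Perm n) → IsMaxInCoset J w v →
    (a b : Fin n) → IsComponent J a b →
    ((StrongLeftDirected (w · v) a ⇔ IsLeftMax w b (v $ a))
     × (IsLeftMax w b (v $ a) ⇔ StrongLeftDirected w (v $ a))
     × (StrongLeftDirected w (v $ a) ⇔ (∃₂ λ p q → IsLeftMax w p q × a ≤ q × q ≤ b)))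
mainTheorem1 J _ w v maxInCoset@(v∈W , _) a b component =
  ·-strongLeftDirected⇔leftMax {w = w} {v} v-preservesCut-a maxOn ,
  maxOn-leftMax⇔strongLeftDirected maxOn ,
  maxOn-strongLeftDirected⇔leftMaxIn maxOn
  where
  maxOn : IsMaxOn w a b (v $ a)
  maxOn = maxInCoset-maxOnComponent maxInCoset component
  v-preservesCut-a : PreservesCut (toℕ a) v
  v-preservesCut-a = proj₁ (component-preservesCutsAround component v∈W)
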